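{- Let $m$ be a positive integer such that there exist a TD$(8,m)$ and a $(7m+1,7,1)$-BIBD, and let $t$ be an integer with $0 \leq t \leq m-1$. Then there exists a $\{7,8\}$-GDD of type $7^{7m}(7t+1)^1$.
   Context: For a set $K$ of positive integers (each at least $2$), a $K$-GDD (group-divisible design) is a triple $(X,\mathcal{G},\mathcal{A})$ where $X$ is a finite set of points, $\mathcal{G}$ is a partition of $X$ into groups, and $\mathcal{A}$ is a collection of subsets (blocks) of $X$ such that every block meets every group in at most one point, every pair of points from different groups lies in exactly one block, and every block has size in $K$. If $K=\{k\}$ we write $k$-GDD. The type is the multiset of group sizes, written exponentially: type $a^{b} c^1$ means $b$ groups of size $a$ and one group of size $c$. A TD$(k,n)$ (transversal design) is a $k$-GDD of type $n^k$. A $(w,k,1)$-BIBD is a set of $w$ points with a collection of $k$-element subsets (blocks) such that every pair of distinct points lies in exactly one block. -}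

module Defs where

open import Data.Nat using (ℕ; _≟_)
open import Data.Fin using (Fin)
open import Data.Fin.Properties using () renaming (_≟_ to _≟ᶠ_)
open import Data.List using (List; length; filter; lookup; allFin; replicate)
open import Data.List.Membership.Propositional using (_∈_)
open import Data.List.Relation.Unary.Unique.Propositional using (Unique)
open import Data.Product using (∃!; _×_)
open import Relation.Binary.PropositionalEquality using (_≡_; _≢_)

groupSize : {n c : ℕ} → (Fin n → Fin c) → Fin c → ℕ
groupSize {n} g i = length (filter (λ x → g x ≟ᶠ i) (allFin n))

-- Points are Fin n; groups are the fibres of groupOf, group i has size
-- lookup type i; blocks are an indexed family of duplicate-free lists.
record GDD (K : ℕ → Set) (type : List ℕ) : Set where
  field
    n          : ℕ
    groupOf    : Fin n → Fin (length type)
    groupSizes : ∀ i → groupSize groupOf i ≡ lookup type i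
    b          : ℕ
    block      : Fin b → List (Fin n)
    blockSet   : ∀ j → Unique (block j)
    blockSize  : ∀ j → K (length (block j))
    transverse : ∀ j x y → x ∈ block j → y ∈ block j → x ≢ y →
                 groupOf x ≢ groupOf y
    pairs      : ∀ x y → groupOf x ≢ groupOf y →
                 ∃! _≡_ (λ j → x ∈ block j × y ∈ block j)

kGDD : ℕ → List ℕ → Set
kGDD k = GDD (λ s → s ≡ k)

TD : ℕ → ℕ → Set
TD k n = kGDD k (replicate k n)

record BIBD (w k : ℕ) : Set where
  field
    b        : ℕ
    block    : Fin b → List (Fin w)
    blockSet : ∀ j → Unique (block j)
    blockSize : ∀ j → length (block j) ≡ k
    pairs    : ∀ (x y : Fin w) → x ≢ y →
               ∃! _≡_ (λ j → x ∈ block j × y ∈ block j)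

module Submission where

-- Take a TD(8,m) with groups G₀, …, G₇ and let the pivot q be the point of G₇ at position t.  Keep the
-- points of G₀, …, G₆ and the first t points of G₇, replace each kept point x by the seven points (x , s),
-- s ∈ ℤ₇, and add a point ∞.  Every block of the TD, restricted to its kept points, is inflated by the
-- TD(8,7) of lines of the affine plane over ℤ₇ (slopes recorded on G₇), giving blocks of size 8 or 7.
-- The m blocks through q inflated by the horizontal lines are not blocks: their point sets
-- (B ∖ {q}) × {s} are the 7m groups of size 7.  The pairs within {∞} ∪ Gᵢ × ℤ₇ (i < 7), which lie in
-- distinct groups, are covered by a copy of the (7m+1,7,1)-BIBD, and ∞ together with the kept part of
-- G₇ × ℤ₇ forms the group of size 7t + 1.

open import Defs
open import Data.Nat using (ℕ; zero; suc; _+_; _*_; _∸_; _≤_; _<_; z≤n; s≤s)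
import Data.Nat as ℕ
open import Data.Nat.DivMod using (_%_; _mod_)
open import Data.Nat.Properties
  using (+-identityʳ; +-suc; +-comm; *-comm; +-cancelʳ-≡; suc-injective; ≤-refl; ≤-antisym; ≤-reflexive; <-irrefl;
         <⇒≤; <⇒≤pred; ≮⇒≥; module ≤-Reasoning)
open import Data.Fin using (Fin; toℕ; fromℕ<; inject₁; lower₁; inject≤; _↑ˡ_; _↑ʳ_; splitAt; combine; remQuot)
  renaming (zero to fzero; suc to fsuc)
import Data.Fin as Fin
import Data.Fin.Properties as Finₚ
open import Data.Fin.Properties using (all?)
open import Data.Maybe using (Maybe; just; nothing)
import Data.Maybe.Properties as Maybeₚ
open import Data.List
  using (List; []; _∷_; [_]; _++_; length; filter; lookup; tabulate; allFin; map; replicate; cartesianProduct)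
open import Data.List.Properties
  using (filter-some; length-removeAt′; length-map; length-tabulate; length-++; length-replicate; lookup-replicate)
open import Data.List.Membership.Propositional using (_∈_; lose)
open import Data.List.Membership.Propositional.Properties
  using (∈-map⁻; ∈-map⁺; ∈-lookup; ∈-allFin; ∈-filter⁺; ∈-filter⁻; ∈-cartesianProduct⁺; ∈-cartesianProduct⁻;
         ∈-++⁺ˡ; ∈-++⁺ʳ; ∈-++⁻; ∈-tabulate⁺; ∈-tabulate⁻)
import Data.List.Membership.DecPropositional as DecMembership
open import Data.List.Relation.Unary.Any using (here; there; index; _─_; any?)
open import Data.List.Relation.Unary.Any.Properties using (lookup-index)
import Data.List.Relation.Unary.All as All
open import Data.List.Relation.Unary.All using ([]; _∷_)
import Data.List.Relation.Unary.All.Properties as Allₚ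
open import Data.List.Relation.Unary.AllPairs using ([]; _∷_)
open import Data.List.Relation.Unary.Unique.Propositional using (Unique)
import Data.List.Relation.Unary.Unique.Propositional.Properties as Uniqueₚ
open import Data.Product using (∃-syntax; _×_; _,_; proj₁; proj₂; ∃!)
import Data.Product.Properties as ×ₚ
open import Data.Sum using (_⊎_; inj₁; inj₂; [_,_]′)
import Data.Sum.Properties as ⊎ₚ
open import Data.Unit using (⊤; tt)
open import Data.Empty using (⊥; ⊥-elim; ⊥-elim-irr)
open import Relation.Nullary using (Dec; yes; no; ¬_)
open import Relation.Nullary.Decidable using (¬?; _×-dec_; _⊎-dec_; toWitness; decidable-stable)
open import Relation.Unary using (Decidable)
open import Relation.Binary using (DecidableEquality)
open import Relation.Binary.PropositionalEquality
  using (_≡_; _≢_; refl; sym; trans; cong; cong₂; subst; module ≡-Reasoning)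
open import Function using (_∘_; id)

private variable
  A B : Set

lookup-injective : ∀ {xs : List A} → Unique xs → ∀ {i j} → lookup xs i ≡ lookup xs j → i ≡ j
lookup-injective {xs = _ ∷ _}  _          {fzero}  {fzero}  _  = refl
lookup-injective {xs = _ ∷ xs} (x∉ ∷ _)   {fzero}  {fsuc j} eq = ⊥-elim (All.lookup x∉ (∈-lookup j) eq)
lookup-injective {xs = _ ∷ xs} (x∉ ∷ _)   {fsuc i} {fzero}  eq = ⊥-elim (All.lookup x∉ (∈-lookup i) (sym eq))
lookup-injective {xs = _ ∷ _}  (_ ∷ uniq) {fsuc i} {fsuc j} eq = cong fsuc (lookup-injective uniq eq)

∈-─ : ∀ {x y : A} {ys} (x∈ys : x ∈ ys) → y ∈ ys → y ≢ x → y ∈ (ys ─ x∈ys)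
∈-─ (here refl) (here refl) y≢x = ⊥-elim (y≢x refl)
∈-─ (here refl) (there y∈) _    = y∈
∈-─ (there _)   (here eq)  _    = here eq
∈-─ (there x∈)  (there y∈) y≢x  = there (∈-─ x∈ y∈ y≢x)

Unique-⊆⇒length-≤ : ∀ {xs ys : List A} → Unique xs → (∀ {x} → x ∈ xs → x ∈ ys) → length xs ≤ length ys
Unique-⊆⇒length-≤ {xs = []}     _            _  = z≤n
Unique-⊆⇒length-≤ {xs = x ∷ xs} {ys} (x∉ ∷ uniq) xs⊆ys =
  subst (suc (length xs) ≤_) (sym (length-removeAt′ ys (index x∈ys)))
    (s≤s (Unique-⊆⇒length-≤ uniq λ y∈xs → ∈-─ x∈ys (xs⊆ys (there y∈xs)) (λ y≡x → All.lookup x∉ y∈xs (sym y≡x))))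
  where x∈ys = xs⊆ys (here refl)

Unique-⇔⇒length-≡ : ∀ {xs ys : List A} → Unique xs → Unique ys →
                    (∀ {x} → x ∈ xs → x ∈ ys) → (∀ {x} → x ∈ ys → x ∈ xs) → length xs ≡ length ys
Unique-⇔⇒length-≡ uxs uys to from = ≤-antisym (Unique-⊆⇒length-≤ uxs to) (Unique-⊆⇒length-≤ uys from)

Unique-complete : ∀ {n} {xs : List (Fin n)} → Unique xs → length xs ≡ n → ∀ i → i ∈ xs
Unique-complete {n} {xs} uniq len≡n i with any? (i Finₚ.≟_) xs
... | yes i∈xs = i∈xs
... | no  i∉xs = ⊥-elim (<-irrefl refl (begin-strict
  length xs                 ≤⟨ Unique-⊆⇒length-≤ uniq (λ y∈xs → ∈-─ i∈all (∈-allFin _) λ { refl → i∉xs y∈xs }) ⟩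
  length (allFin n ─ i∈all) <⟨ ≤-reflexive (sym (length-removeAt′ (allFin n) (index i∈all))) ⟩
  length (allFin n)         ≡⟨ length-tabulate id ⟩
  n                         ≡⟨ sym len≡n ⟩
  length xs                 ∎))
  where
  open ≤-Reasoning
  i∈all = ∈-allFin i

length-filter-tabulate : ∀ {P : B → Set} {Q : A → Set} (P? : Decidable P) (Q? : Decidable Q)
                         (xs : List A) (f : Fin (length xs) → B) →
                         (∀ i → P (f i) → Q (lookup xs i)) → (∀ i → Q (lookup xs i) → P (f i)) →
                         length (filter P? (tabulate f)) ≡ length (filter Q? xs)
length-filter-tabulate P? Q? []       f _  _  = refl
length-filter-tabulate P? Q? (x ∷ xs) f to from with P? (f fzero) | Q? x
... | yes _  | yes _  = cong suc (length-filter-tabulate P? Q? xs (f ∘ fsuc) (to ∘ fsuc) (from ∘ fsuc))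
... | yes p  | no ¬q  = ⊥-elim (¬q (to fzero p))
... | no ¬p  | yes q  = ⊥-elim (¬p (from fzero q))
... | no _   | no _   = length-filter-tabulate P? Q? xs (f ∘ fsuc) (to ∘ fsuc) (from ∘ fsuc)

length-filter-complement : ∀ {P : A → Set} (P? : Decidable P) xs →
                           length (filter P? xs) + length (filter (¬? ∘ P?) xs) ≡ length xs
length-filter-complement P? []       = refl
length-filter-complement P? (x ∷ xs) with P? x
... | yes _ = cong suc (length-filter-complement P? xs)
... | no  _ = trans (+-suc _ _) (cong suc (length-filter-complement P? xs))

+≡suc⇒≡∨≡pred : ∀ a b {c} → a + b ≡ suc c → b ≤ 1 → a ≡ suc c ⊎ a ≡ c
+≡suc⇒≡∨≡pred a zero       eq _ = inj₁ (trans (sym (+-identityʳ a)) eq)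
+≡suc⇒≡∨≡pred a (suc zero) eq _ = inj₂ (suc-injective (trans (+-comm 1 a) eq))
+≡suc⇒≡∨≡pred a (suc (suc b)) _ (s≤s ())

length-cartesianProduct : ∀ (xs : List A) (ys : List B) → length (cartesianProduct xs ys) ≡ length xs * length ys
length-cartesianProduct []       ys = refl
length-cartesianProduct (x ∷ xs) ys = begin
  length (map (x ,_) ys ++ cartesianProduct xs ys)
    ≡⟨ length-++ (map (x ,_) ys) ⟩
  length (map (x ,_) ys) + length (cartesianProduct xs ys)
    ≡⟨ cong₂ _+_ (length-map (x ,_) ys) (length-cartesianProduct xs ys) ⟩
  length ys + length xs * length ys
    ∎
  where open ≡-Reasoning

lookup-replicate-++ˡ : ∀ a (v : ℕ) ys (i : Fin (length (replicate a v ++ ys))) → toℕ i < a →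
                       lookup (replicate a v ++ ys) i ≡ v
lookup-replicate-++ˡ (suc a) v ys fzero    _          = refl
lookup-replicate-++ˡ (suc a) v ys (fsuc i) (s≤s i<a) = lookup-replicate-++ˡ a v ys i i<a

lookup-replicate-++ʳ : ∀ a (v w : ℕ) (i : Fin (length (replicate a v ++ [ w ]))) → ¬ toℕ i < a →
                       lookup (replicate a v ++ [ w ]) i ≡ w
lookup-replicate-++ʳ zero    v w fzero    _   = refl
lookup-replicate-++ʳ (suc a) v w fzero    i≮a = ⊥-elim (i≮a (s≤s z≤n))
lookup-replicate-++ʳ (suc a) v w (fsuc i) i≮a = lookup-replicate-++ʳ a v w i (i≮a ∘ s≤s)

length≤1 : ∀ {xs : List A} → Unique xs → (∀ {x y} → x ∈ xs → y ∈ xs → x ≡ y) → length xs ≤ 1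
length≤1 {xs = []}         _                _   = z≤n
length≤1 {xs = _ ∷ []}     _                _   = s≤s z≤n
length≤1 {xs = _ ∷ _ ∷ _} ((x≢y ∷ _) ∷ _) all≡ = ⊥-elim (x≢y (all≡ (here refl) (there (here refl))))

map-Unique : ∀ {f : A → B} {xs} → (∀ {x y} → x ∈ xs → y ∈ xs → f x ≡ f y → x ≡ y) → Unique xs → Unique (map f xs)
map-Unique {xs = []}     _   []          = []
map-Unique {xs = x ∷ xs} inj (x∉ ∷ uniq) =
  Allₚ.map⁺ (All.tabulate λ y∈ fx≡fy → All.lookup x∉ y∈ (inj (here refl) (there y∈) fx≡fy))
  ∷ map-Unique (λ x∈ y∈ → inj (there x∈) (there y∈)) uniq

record ListGDD (K : ℕ → Set) (type : List ℕ) : Set₁ where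
  field
    Point          : Set
    _≟_            : DecidableEquality Point
    points         : List Point
    points-unique  : Unique points
    group          : Point → ℕ
    group<         : ∀ p → group p < length type
    group-size     : ∀ i → length (filter (λ p → group p ℕ.≟ toℕ i) points) ≡ lookup type i
    Block          : Set
    blocks         : List Block
    blocks-unique  : Unique blocks
    members        : Block → List Point
    members-unique : ∀ β → Unique (members β)
    members⊆points : ∀ β {p} → p ∈ members β → p ∈ points
    block-size     : ∀ β → K (length (members β))
    transverse     : ∀ β → β ∈ blocks → ∀ {p q} → p ∈ members β → q ∈ members β → p ≢ q → group p ≢ group q
    covered        : ∀ {p q} → p ∈ points → q ∈ points → group p ≢ group q →
                     ∃[ β ] β ∈ blocks × p ∈ members β × q ∈ members β
    covered-once   : ∀ β β' {p q} → p ≢ q → p ∈ members β → q ∈ members β →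
                     p ∈ members β' → q ∈ members β' → β ≡ β'

module _ {K : ℕ → Set} {type : List ℕ} (G : ListGDD K type) where
  open ListGDD G

  private
    N = length points

    toPoint : Fin N → Point
    toPoint = lookup points

    groupOf : Fin N → Fin (length type)
    groupOf x = fromℕ< (group< (toPoint x))

    groupOf≡⇒group≡ : ∀ {x y} → groupOf x ≡ groupOf y → group (toPoint x) ≡ group (toPoint y)
    groupOf≡⇒group≡ eq = trans (sym (Finₚ.toℕ-fromℕ< _)) (trans (cong toℕ eq) (Finₚ.toℕ-fromℕ< _))

    member? : ∀ β → Decidable (λ x → toPoint x ∈ members β)
    member? β x = toPoint x ∈? members β
      where open DecMembership _≟_

    memberIndices : Block → List (Fin N)
    memberIndices β = filter (member? β) (allFin N)

    ∈-memberIndices⁺ : ∀ {β x} → toPoint x ∈ members β → x ∈ memberIndices β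
    ∈-memberIndices⁺ {β} = ∈-filter⁺ (member? β) (∈-allFin _)

    ∈-memberIndices⁻ : ∀ {β x} → x ∈ memberIndices β → toPoint x ∈ members β
    ∈-memberIndices⁻ {β} = proj₂ ∘ ∈-filter⁻ (member? β) {xs = allFin N}

    memberIndices-unique : ∀ β → Unique (memberIndices β)
    memberIndices-unique β = Uniqueₚ.filter⁺ (member? β) (Uniqueₚ.allFin⁺ N)

    length-memberIndices : ∀ β → length (memberIndices β) ≡ length (members β)
    length-memberIndices β = trans (sym (length-map toPoint (memberIndices β)))
      (Unique-⇔⇒length-≡ (Uniqueₚ.map⁺ (lookup-injective points-unique) (memberIndices-unique β))
                          (members-unique β) to from)
      where
      to : ∀ {p} → p ∈ map toPoint (memberIndices β) → p ∈ members β
      to p∈ with x , x∈ , refl ← ∈-map⁻ toPoint p∈ = ∈-memberIndices⁻ x∈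
      from : ∀ {p} → p ∈ members β → p ∈ map toPoint (memberIndices β)
      from p∈ = subst (_∈ map toPoint (memberIndices β)) (sym (lookup-index (members⊆points β p∈)))
                  (∈-map⁺ toPoint (∈-memberIndices⁺ (subst (_∈ members β) (lookup-index (members⊆points β p∈)) p∈)))

    block : Fin (length blocks) → List (Fin N)
    block = memberIndices ∘ lookup blocks

    pairs : ∀ x y → groupOf x ≢ groupOf y → ∃! _≡_ (λ j → x ∈ block j × y ∈ block j)
    pairs x y gx≢gy = unique-block (covered (∈-lookup x) (∈-lookup y) (gx≢gy ∘ Finₚ.toℕ-injective ∘ group≡))
      where
      group≡ : group (toPoint x) ≡ group (toPoint y) → toℕ (groupOf x) ≡ toℕ (groupOf y)
      group≡ eq = trans (Finₚ.toℕ-fromℕ< _) (trans eq (sym (Finₚ.toℕ-fromℕ< _)))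
      x≢y : toPoint x ≢ toPoint y
      x≢y eq = gx≢gy (Finₚ.toℕ-injective (group≡ (cong group eq)))
      unique-block : ∃[ β ] β ∈ blocks × toPoint x ∈ members β × toPoint y ∈ members β →
                     ∃! _≡_ (λ j → x ∈ block j × y ∈ block j)
      unique-block (β , β∈ , x∈β , y∈β) =
        index β∈ , (memberOf x∈β , memberOf y∈β) , λ (x∈ , y∈) → lookup-injective blocks-unique
          (trans (sym (lookup-index β∈)) (covered-once _ _ x≢y x∈β y∈β (∈-memberIndices⁻ x∈) (∈-memberIndices⁻ y∈)))
        where
        memberOf : ∀ {z} → toPoint z ∈ members β → z ∈ block (index β∈)
        memberOf z∈ = ∈-memberIndices⁺ (subst (λ β' → _ ∈ members β') (lookup-index β∈) z∈)

  listGDD⇒GDD : GDD K type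
  listGDD⇒GDD = record
    { n          = N
    ; groupOf    = groupOf
    ; groupSizes = λ i → trans
        (length-filter-tabulate (λ x → groupOf x Finₚ.≟ i) (λ p → group p ℕ.≟ toℕ i) points id
          (λ x eq → trans (sym (Finₚ.toℕ-fromℕ< _)) (cong toℕ eq))
          (λ x eq → Finₚ.toℕ-injective (trans (Finₚ.toℕ-fromℕ< _) eq)))
        (group-size i)
    ; b          = length blocks
    ; block      = block
    ; blockSet   = memberIndices-unique ∘ lookup blocks
    ; blockSize  = λ j → subst K (sym (length-memberIndices (lookup blocks j))) (block-size (lookup blocks j))
    ; transverse = λ j x y x∈ y∈ x≢y gx≡gy → transverse (lookup blocks j) (∈-lookup j)
        (∈-memberIndices⁻ x∈) (∈-memberIndices⁻ y∈) (x≢y ∘ lookup-injective points-unique) (groupOf≡⇒group≡ gx≡gy)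
    ; pairs      = pairs
    }

module GDDProperties {K : ℕ → Set} {type : List ℕ} (G : GDD K type) where
  open GDD G

  groupMembers : Fin (length type) → List (Fin n)
  groupMembers i = filter (λ x → groupOf x Finₚ.≟ i) (allFin n)

  groupMembers-unique : ∀ i → Unique (groupMembers i)
  groupMembers-unique i = Uniqueₚ.filter⁺ (λ x → groupOf x Finₚ.≟ i) (Uniqueₚ.allFin⁺ n)

  ∈-groupMembers⁺ : ∀ {x i} → groupOf x ≡ i → x ∈ groupMembers i
  ∈-groupMembers⁺ {x} {i} = ∈-filter⁺ (λ x → groupOf x Finₚ.≟ i) (∈-allFin x)

  ∈-groupMembers⁻ : ∀ {x i} → x ∈ groupMembers i → groupOf x ≡ i
  ∈-groupMembers⁻ {i = i} = proj₂ ∘ ∈-filter⁻ (λ x → groupOf x Finₚ.≟ i) {xs = allFin n}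

  -- The proof argument is irrelevant so that the block does not depend on it.
  blockThrough : ∀ x y → .(groupOf x ≢ groupOf y) → Fin b
  blockThrough x y gx≢gy = proj₁ (pairs x y λ eq → ⊥-elim-irr (gx≢gy eq))

  ∈-blockThroughˡ : ∀ x y .(gx≢gy : groupOf x ≢ groupOf y) → x ∈ block (blockThrough x y gx≢gy)
  ∈-blockThroughˡ x y gx≢gy = proj₁ (proj₁ (proj₂ (pairs x y λ eq → ⊥-elim-irr (gx≢gy eq))))

  ∈-blockThroughʳ : ∀ x y .(gx≢gy : groupOf x ≢ groupOf y) → y ∈ block (blockThrough x y gx≢gy)
  ∈-blockThroughʳ x y gx≢gy = proj₂ (proj₁ (proj₂ (pairs x y λ eq → ⊥-elim-irr (gx≢gy eq))))

  blockThrough-unique : ∀ x y .(gx≢gy : groupOf x ≢ groupOf y) {j} → x ∈ block j → y ∈ block j →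
                        blockThrough x y gx≢gy ≡ j
  blockThrough-unique x y gx≢gy x∈ y∈ = proj₂ (proj₂ (pairs x y λ eq → ⊥-elim-irr (gx≢gy eq))) (x∈ , y∈)

  block-unique : ∀ {x y} → groupOf x ≢ groupOf y → ∀ {j j'} →
                 x ∈ block j → y ∈ block j → x ∈ block j' → y ∈ block j' → j ≡ j'
  block-unique {x} {y} gx≢gy x∈j y∈j x∈j' y∈j' =
    trans (sym (blockThrough-unique x y gx≢gy x∈j y∈j)) (blockThrough-unique x y gx≢gy x∈j' y∈j')

  same-group⇒≡ : ∀ j {x y} → x ∈ block j → y ∈ block j → groupOf x ≡ groupOf y → x ≡ y
  same-group⇒≡ j {x} {y} x∈ y∈ gx≡gy with x Finₚ.≟ y
  ... | yes x≡y = x≡y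
  ... | no  x≢y = ⊥-elim (transverse j x y x∈ y∈ x≢y gx≡gy)

  length-filter-block≤1 : ∀ j {Q : Fin n → Set} (Q? : Decidable Q) {i} → (∀ {z} → Q z → groupOf z ≡ i) →
                          length (filter Q? (block j)) ≤ 1
  length-filter-block≤1 j Q? Q⇒i = length≤1 (Uniqueₚ.filter⁺ Q? (blockSet j)) λ x∈ y∈ →
    let x∈' = ∈-filter⁻ Q? {xs = block j} x∈ ; y∈' = ∈-filter⁻ Q? {xs = block j} y∈
    in same-group⇒≡ j (proj₁ x∈') (proj₁ y∈') (trans (Q⇒i (proj₂ x∈')) (sym (Q⇒i (proj₂ y∈'))))

  groups-of-block-unique : ∀ j → Unique (map groupOf (block j))
  groups-of-block-unique j = map-Unique (same-group⇒≡ j) (blockSet j)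

  block-meets-group : ∀ j → length (block j) ≡ length type → ∀ i → ∃[ y ] y ∈ block j × groupOf y ≡ i
  block-meets-group j full i
    with y , y∈ , refl ← ∈-map⁻ groupOf
           (Unique-complete (groups-of-block-unique j) (trans (length-map groupOf (block j)) full) i)
    = y , y∈ , refl

  module UniformGroups {m} (uniform : ∀ i → length (groupMembers i) ≡ m) where

    member : Fin (length type) → Fin m → Fin n
    member i k = lookup (groupMembers i) (Fin.cast (sym (uniform i)) k)

    position : Fin n → Fin m
    position x = Fin.cast (uniform (groupOf x)) (index (∈-groupMembers⁺ {x} refl))

    groupOf-member : ∀ i k → groupOf (member i k) ≡ i
    groupOf-member i k = ∈-groupMembers⁻ (∈-lookup (Fin.cast (sym (uniform i)) k))

    member-position : ∀ x → member (groupOf x) (position x) ≡ x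
    member-position x = trans (cong (lookup (groupMembers (groupOf x))) (Finₚ.cast-involutive {m = m} _ _ _))
                              (sym (lookup-index (∈-groupMembers⁺ {x} refl)))

    member-injective : ∀ i {k k'} → member i k ≡ member i k' → k ≡ k'
    member-injective i {k} {k'} eq = Finₚ.toℕ-injective (begin
      toℕ k                              ≡⟨ Finₚ.toℕ-cast _ k ⟨
      toℕ (Fin.cast (sym (uniform i)) k)  ≡⟨ cong toℕ (lookup-injective (groupMembers-unique i) eq) ⟩
      toℕ (Fin.cast (sym (uniform i)) k') ≡⟨ Finₚ.toℕ-cast _ k' ⟩
      toℕ k'                             ∎)
      where open ≡-Reasoning

    position-member : ∀ i k → position (member i k) ≡ k
    position-member i k = member-injective i (begin
      member i (position (member i k))
        ≡⟨ cong (λ g → member g (position (member i k))) (groupOf-member i k) ⟨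
      member (groupOf (member i k)) (position (member i k))
        ≡⟨ member-position (member i k) ⟩
      member i k
        ∎)
      where open ≡-Reasoning

g₇ : Fin 8
g₇ = Fin.fromℕ 7

-- The point (i , v) with i < 7 lies on the block (a , b) when v = a i + b in ℤ₇ (the lines of the affine
-- plane over ℤ₇), and (7 , v) when v = a (the point at infinity of the slope-a parallel class).
line : Fin 8 → Fin 7 → Fin 7 → Fin 7
line i a b with toℕ i ℕ.≟ 7
... | yes _ = a
... | no  _ = (toℕ a * toℕ i + toℕ b) mod 7

-- Inversion in ℤ₇; the value at 0 is arbitrary.
inverse₇ : ℕ → ℕ
inverse₇ 2 = 4
inverse₇ 3 = 5
inverse₇ 4 = 2
inverse₇ 5 = 3
inverse₇ 6 = 6
inverse₇ _ = 1

-- The line through (i , v) and (i' , v'); the constants 7 and 7 * 7 keep the truncated subtractions positive.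
lineThrough : Fin 8 → Fin 8 → Fin 7 → Fin 7 → Fin 7 × Fin 7
lineThrough i i' v v' with toℕ i ℕ.≟ 7 | toℕ i' ℕ.≟ 7
... | yes _ | _     = v , (toℕ v' + 7 * 7 ∸ toℕ v * toℕ i') mod 7
... | no _  | yes _ = v' , (toℕ v + 7 * 7 ∸ toℕ v' * toℕ i) mod 7
... | no _  | no _  = let a = (toℕ v + 7 ∸ toℕ v') * inverse₇ ((toℕ i + 7 ∸ toℕ i') % 7) % 7
                      in a mod 7 , (toℕ v + 7 * 7 ∸ a * toℕ i) mod 7

_≟²_ : DecidableEquality (Fin 7 × Fin 7)
_≟²_ = ×ₚ.≡-dec Finₚ._≟_ Finₚ._≟_

abstract
  lineThrough-line : ∀ i i' a b → i ≡ i' ⊎ lineThrough i i' (line i a b) (line i' a b) ≡ (a , b)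
  lineThrough-line = toWitness {a? = all? λ i → all? λ i' → all? λ a → all? λ b →
    (i Finₚ.≟ i') ⊎-dec (lineThrough i i' (line i a b) (line i' a b) ≟² (a , b))} _

  line-lineThrough : ∀ i i' v v' → i ≡ i' ⊎ (let (a , b) = lineThrough i i' v v' in line i a b ≡ v × line i' a b ≡ v')
  line-lineThrough = toWitness {a? = all? λ i → all? λ i' → all? λ v → all? λ v' →
    (i Finₚ.≟ i') ⊎-dec
    (let (a , b) = lineThrough i i' v v' in (line i a b Finₚ.≟ v) ×-dec (line i' a b Finₚ.≟ v'))} _

  equal-values⇒horizontal : ∀ i i' a b → i ≡ g₇ ⊎ i' ≡ g₇ ⊎ i ≡ i' ⊎ line i a b ≢ line i' a b ⊎ a ≡ fzero
  equal-values⇒horizontal = toWitness {a? = all? λ i → all? λ i' → all? λ a → all? λ b →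
    (i Finₚ.≟ g₇) ⊎-dec (i' Finₚ.≟ g₇) ⊎-dec (i Finₚ.≟ i') ⊎-dec
    ¬? (line i a b Finₚ.≟ line i' a b) ⊎-dec (a Finₚ.≟ fzero)} _

  line-horizontal : ∀ i b → i ≡ g₇ ⊎ line i fzero b ≡ b
  line-horizontal = toWitness {a? = all? λ i → all? λ b → (i Finₚ.≟ g₇) ⊎-dec (line i fzero b Finₚ.≟ b)} _

module Construction (m t : ℕ) (t<m : t < m) (T : TD 8 m) (D : BIBD (7 * m + 1) 7) where
  open GDD T using (groupOf; groupSizes; block; blockSet; blockSize)
  open GDDProperties T
  module D = BIBD D

  X : Set
  X = Fin (GDD.n T)

  groups-of-size-m : ∀ i → length (groupMembers i) ≡ m
  groups-of-size-m i = trans (groupSizes i)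
    (trans (cong (lookup (replicate 8 m)) (sym (Finₚ.cast-is-id _ i))) (lookup-replicate 8 m i))

  open UniformGroups groups-of-size-m

  Short : X → Set
  Short x = groupOf x ≢ g₇

  short? : Decidable Short
  short? x = ¬? (groupOf x Finₚ.≟ g₇)

  Kept : X → Set
  Kept x = Short x ⊎ toℕ (position x) < t

  kept? : Decidable Kept
  kept? x = short? x ⊎-dec (toℕ (position x) ℕ.<? t)

  long⇒≡g₇ : ∀ {x} → ¬ Short x → groupOf x ≡ g₇
  long⇒≡g₇ {x} = decidable-stable (groupOf x Finₚ.≟ g₇)

  unkept⇒long : ∀ {x} → ¬ Kept x → groupOf x ≡ g₇
  unkept⇒long unkept = long⇒≡g₇ (unkept ∘ inj₁)

  pivot : X
  pivot = member g₇ (fromℕ< t<m)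

  groupOf-pivot : groupOf pivot ≡ g₇
  groupOf-pivot = groupOf-member g₇ _

  pivot-not-kept : ¬ Kept pivot
  pivot-not-kept (inj₁ short) = short groupOf-pivot
  pivot-not-kept (inj₂ <t) = <-irrefl (trans (cong toℕ (position-member g₇ _)) (Finₚ.toℕ-fromℕ< t<m)) <t

  kept-in-pivot-block⇒short : ∀ {x j} → Kept x → x ∈ block j → pivot ∈ block j → Short x
  kept-in-pivot-block⇒short kept x∈ pivot∈ long = pivot-not-kept
    (subst Kept (same-group⇒≡ _ x∈ pivot∈ (trans long (sym groupOf-pivot))) kept)

  short⇒≢pivot : ∀ {x} → Short x → groupOf x ≢ groupOf pivot
  short⇒≢pivot short eq = short (trans eq groupOf-pivot)

  pivotBlock : ∀ x → .(Short x) → Fin (GDD.b T)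
  pivotBlock x short = blockThrough x pivot (short⇒≢pivot short)

  member₀-short : ∀ k → Short (member fzero k)
  member₀-short k eq = fzero≢g₇ (trans (sym (groupOf-member fzero k)) eq)
    where
    fzero≢g₇ : fzero ≢ g₇
    fzero≢g₇ ()

  pivotBlockAt : Fin m → Fin (GDD.b T)
  pivotBlockAt k = pivotBlock (member fzero k) (member₀-short k)

  pivot-∈-pivotBlockAt : ∀ k → pivot ∈ block (pivotBlockAt k)
  pivot-∈-pivotBlockAt k = ∈-blockThroughʳ (member fzero k) pivot (short⇒≢pivot (member₀-short k))

  anchor : ∀ x → .(Short x) → X
  anchor x short = proj₁ (block-meets-group (pivotBlock x short) (blockSize _) fzero)

  -- The block through x and the pivot is numbered by the position of its point in G₀.
  slot : ∀ x → .(Short x) → Fin m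
  slot x short = position (anchor x short)

  anchor-∈ : ∀ x .(short : Short x) → anchor x short ∈ block (pivotBlock x short)
  anchor-∈ x short = proj₁ (proj₂ (block-meets-group (pivotBlock x short) (blockSize _) fzero))

  groupOf-anchor : ∀ x .(short : Short x) → groupOf (anchor x short) ≡ fzero
  groupOf-anchor x short = proj₂ (proj₂ (block-meets-group (pivotBlock x short) (blockSize _) fzero))

  ∈-pivotBlockAt-slot : ∀ x (short : Short x) → x ∈ block (pivotBlockAt (slot x short))
  ∈-pivotBlockAt-slot x short =
    subst (λ j → x ∈ block j) (sym same-block) (∈-blockThroughˡ x pivot (short⇒≢pivot short))
    where
    a = anchor x short
    member-slot : member fzero (slot x short) ≡ a
    member-slot = trans (cong (λ g → member g (position a)) (sym (groupOf-anchor x short))) (member-position a)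
    same-block : pivotBlockAt (slot x short) ≡ pivotBlock x short
    same-block = blockThrough-unique (member fzero (slot x short)) pivot (short⇒≢pivot (member₀-short _))
      (subst (_∈ block (pivotBlock x short)) (sym member-slot) (anchor-∈ x short))
      (∈-blockThroughʳ x pivot (short⇒≢pivot short))

  slot-unique : ∀ x (short : Short x) k → x ∈ block (pivotBlockAt k) → slot x short ≡ k
  slot-unique x short k x∈ = begin
    position (anchor x short)    ≡⟨ cong position anchor≡member ⟩
    position (member fzero k)    ≡⟨ position-member fzero k ⟩
    k                            ∎
    where
    open ≡-Reasoning
    same-block : pivotBlock x short ≡ pivotBlockAt k
    same-block = blockThrough-unique x pivot (short⇒≢pivot short) x∈ (pivot-∈-pivotBlockAt k)
    anchor≡member : anchor x short ≡ member fzero k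
    anchor≡member = same-group⇒≡ (pivotBlockAt k)
      (subst (λ j → anchor x short ∈ block j) same-block (anchor-∈ x short))
      (∈-blockThroughˡ (member fzero k) pivot (short⇒≢pivot (member₀-short k)))
      (trans (groupOf-anchor x short) (sym (groupOf-member fzero k)))

  pivot-block-slot : ∀ x (short : Short x) {j} → x ∈ block j → pivot ∈ block j → j ≡ pivotBlockAt (slot x short)
  pivot-block-slot x short x∈ pivot∈ =
    block-unique (short⇒≢pivot short) x∈ pivot∈ (∈-pivotBlockAt-slot x short) (pivot-∈-pivotBlockAt _)

  same-slot⇒≡ : ∀ {x y} (sx : Short x) (sy : Short y) → groupOf x ≡ groupOf y → slot x sx ≡ slot y sy → x ≡ y
  same-slot⇒≡ {x} {y} sx sy gx≡gy slot≡ = same-group⇒≡ (pivotBlockAt (slot x sx)) (∈-pivotBlockAt-slot x sx)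
    (subst (λ k → y ∈ block (pivotBlockAt k)) (sym slot≡) (∈-pivotBlockAt-slot y sy)) gx≡gy

  Point : Set
  Point = Maybe (X × Fin 7)

  -- Group toℕ (combine s k) < 7m consists of the points with digit s on the k-th block through the pivot;
  -- group 7m is ∞ together with the kept points of G₇.
  groupNo : Point → ℕ
  groupNo nothing        = 7 * m
  groupNo (just (x , s)) with short? x
  ... | yes short = toℕ (combine s (slot x short))
  ... | no  _     = 7 * m

  groupNo-long : ∀ {x} s → ¬ Short x → groupNo (just (x , s)) ≡ 7 * m
  groupNo-long {x} s long with short? x
  ... | yes short = ⊥-elim (long short)
  ... | no  _     = refl

  groupNo-short : ∀ {x} s (short : Short x) → groupNo (just (x , s)) ≡ toℕ (combine s (slot x short))
  groupNo-short {x} s short with short? x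
  ... | yes _    = refl
  ... | no  long = ⊥-elim (long short)

  groupNo-short< : ∀ {x} s → Short x → groupNo (just (x , s)) < 7 * m
  groupNo-short< s short = subst (_< 7 * m) (sym (groupNo-short s short)) (Finₚ.toℕ<n _)

  groupNo≤ : ∀ p → groupNo p ≤ 7 * m
  groupNo≤ nothing        = ≤-refl
  groupNo≤ (just (x , s)) with short? x
  ... | yes _ = <⇒≤ (Finₚ.toℕ<n _)
  ... | no  _ = ≤-refl

  groupNo-short-injective : ∀ {x y s s'} (sx : Short x) (sy : Short y) →
                            groupNo (just (x , s)) ≡ groupNo (just (y , s')) → s ≡ s' × slot x sx ≡ slot y sy
  groupNo-short-injective {s = s} {s'} sx sy eq = Finₚ.combine-injective s _ s' _
    (Finₚ.toℕ-injective (trans (sym (groupNo-short s sx)) (trans eq (groupNo-short s' sy))))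

  points : List Point
  points = nothing ∷ map just (filter (kept? ∘ proj₁) (cartesianProduct (allFin _) (allFin 7)))

  points-unique : Unique points
  points-unique = Allₚ.map⁺ (All.universal (λ _ ()) _)
    ∷ Uniqueₚ.map⁺ Maybeₚ.just-injective (Uniqueₚ.filter⁺ (kept? ∘ proj₁)
        (Uniqueₚ.cartesianProduct⁺ (Uniqueₚ.allFin⁺ _) (Uniqueₚ.allFin⁺ 7)))

  ∈-points⁺ : ∀ {x} s → Kept x → just (x , s) ∈ points
  ∈-points⁺ {x} s kept =
    there (∈-map⁺ just (∈-filter⁺ (kept? ∘ proj₁) (∈-cartesianProduct⁺ (∈-allFin x) (∈-allFin s)) kept))

  ∈-points⁻ : ∀ {x s} → just (x , s) ∈ points → Kept x
  ∈-points⁻ (there p∈) with _ , w∈ , refl ← ∈-map⁻ just p∈ =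
    proj₂ (∈-filter⁻ (kept? ∘ proj₁) {xs = cartesianProduct (allFin _) (allFin 7)} w∈)

  inject₁-short : ∀ {x i} → groupOf x ≡ inject₁ i → Short x
  inject₁-short gx≡ long = Finₚ.fromℕ≢inject₁ (trans (sym long) gx≡)

  short⇒inject₁ : ∀ {x} → Short x → ∃[ i ] groupOf x ≡ inject₁ i
  short⇒inject₁ {x} short = lower₁ (groupOf x) 7≢ , sym (Finₚ.inject₁-lower₁ (groupOf x) 7≢)
    where
    7≢ : 7 ≢ toℕ (groupOf x)
    7≢ eq = short (Finₚ.toℕ-injective (trans (sym eq) (sym (Finₚ.toℕ-fromℕ 7))))

  OnCopy : Fin 7 → Point → Set
  OnCopy i nothing        = ⊤
  OnCopy i (just (x , _)) = groupOf x ≡ inject₁ i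

  place : Fin 7 → Fin 7 × Fin m → Point
  place i (s , k) = just (member (inject₁ i) k , s)

  -- The (7m+1)-point set of the i-th copy of the BIBD is {∞} ∪ (group i × ℤ₇).
  copy : Fin 7 → Fin (7 * m + 1) → Point
  copy i u = [ place i ∘ remQuot m , (λ _ → nothing) ]′ (splitAt (7 * m) u)

  uncopy : Point → Fin (7 * m + 1)
  uncopy nothing        = 7 * m ↑ʳ fzero
  uncopy (just (x , s)) = combine s (position x) ↑ˡ 1

  copy-OnCopy : ∀ i u → OnCopy i (copy i u)
  copy-OnCopy i u with splitAt (7 * m) u
  ... | inj₁ w = groupOf-member (inject₁ i) _
  ... | inj₂ _ = tt

  uncopy-copy : ∀ i u → uncopy (copy i u) ≡ u
  uncopy-copy i u with splitAt (7 * m) u in eq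
  ... | inj₁ w = begin
    combine s (position (member (inject₁ i) k)) ↑ˡ 1  ≡⟨ cong (λ k' → combine s k' ↑ˡ 1) (position-member _ k) ⟩
    combine s k ↑ˡ 1                                  ≡⟨ cong (_↑ˡ 1) (Finₚ.combine-remQuot {n = 7} m w) ⟩
    w ↑ˡ 1                                            ≡⟨ Finₚ.splitAt⁻¹-↑ˡ eq ⟩
    u                                                 ∎
    where
    open ≡-Reasoning
    s = proj₁ (remQuot m w)
    k = proj₂ (remQuot m w)
  ... | inj₂ fzero = Finₚ.splitAt⁻¹-↑ʳ eq

  copy-uncopy : ∀ i p → OnCopy i p → copy i (uncopy p) ≡ p
  copy-uncopy i nothing _ rewrite Finₚ.splitAt-↑ʳ (7 * m) 1 fzero = refl
  copy-uncopy i (just (x , s)) gx≡ = begin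
    copy i (combine s (position x) ↑ˡ 1)
      ≡⟨ cong [ place i ∘ remQuot m , (λ _ → nothing) ]′ (Finₚ.splitAt-↑ˡ (7 * m) (combine s (position x)) 1) ⟩
    place i (remQuot m (combine s (position x)))  ≡⟨ cong (place i) (Finₚ.remQuot-combine s (position x)) ⟩
    just (member (inject₁ i) (position x) , s)    ≡⟨ cong (λ g → just (member g (position x) , s)) gx≡ ⟨
    just (member (groupOf x) (position x) , s)    ≡⟨ cong (λ y → just (y , s)) (member-position x) ⟩
    just (x , s)                                  ∎
    where open ≡-Reasoning

  copy-injective : ∀ i {u u'} → copy i u ≡ copy i u' → u ≡ u'
  copy-injective i {u} {u'} eq = trans (sym (uncopy-copy i u)) (trans (cong uncopy eq) (uncopy-copy i u'))

  OnCopy-∈-points : ∀ i p → OnCopy i p → p ∈ points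
  OnCopy-∈-points i nothing        _   = here refl
  OnCopy-∈-points i (just (x , s)) gx≡ = ∈-points⁺ s (inj₁ (inject₁-short gx≡))

  OnCopy-unique : ∀ {i i' x s} → OnCopy i (just (x , s)) → OnCopy i' (just (x , s)) → i ≡ i'
  OnCopy-unique gx≡i gx≡i' = Finₚ.inject₁-injective (trans (sym gx≡i) gx≡i')

  lift : Fin 7 → Fin 7 → X → Point
  lift a b x = just (x , line (groupOf x) a b)

  Block : Set
  Block = (Fin 7 × Fin D.b) ⊎ (Fin (GDD.b T) × Fin 7 × Fin 7)

  members : Block → List Point
  members (inj₁ (i , j))     = map (copy i) (D.block j)
  members (inj₂ (j , a , b)) = map (lift a b) (filter kept? (block j))

  -- These lifted blocks are exactly the groups of size 7, so they are left out.
  IsGroup : Fin (GDD.b T) × Fin 7 × Fin 7 → Set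
  IsGroup (j , a , _) = pivot ∈ block j × a ≡ fzero

  isGroup? : Decidable IsGroup
  isGroup? (j , a , _) = (pivot ∈? block j) ×-dec (a Finₚ.≟ fzero)
    where open DecMembership Finₚ._≟_

  copyBlocks : List (Fin 7 × Fin D.b)
  copyBlocks = cartesianProduct (allFin 7) (allFin D.b)

  liftBlocks : List (Fin (GDD.b T) × Fin 7 × Fin 7)
  liftBlocks = filter (¬? ∘ isGroup?) (cartesianProduct (allFin _) (cartesianProduct (allFin 7) (allFin 7)))

  blocks : List Block
  blocks = map inj₁ copyBlocks ++ map inj₂ liftBlocks

  blocks-unique : Unique blocks
  blocks-unique = Uniqueₚ.++⁺
    (Uniqueₚ.map⁺ ⊎ₚ.inj₁-injective (Uniqueₚ.cartesianProduct⁺ (Uniqueₚ.allFin⁺ 7) (Uniqueₚ.allFin⁺ D.b)))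
    (Uniqueₚ.map⁺ ⊎ₚ.inj₂-injective (Uniqueₚ.filter⁺ (¬? ∘ isGroup?)
      (Uniqueₚ.cartesianProduct⁺ (Uniqueₚ.allFin⁺ _)
        (Uniqueₚ.cartesianProduct⁺ (Uniqueₚ.allFin⁺ 7) (Uniqueₚ.allFin⁺ 7)))))
    λ (β∈₁ , β∈₂) → disjoint (∈-map⁻ inj₁ β∈₁) (∈-map⁻ inj₂ β∈₂)
    where
    disjoint : ∀ {β : Block} → (∃[ c ] c ∈ copyBlocks × β ≡ inj₁ c) → (∃[ l ] l ∈ liftBlocks × β ≡ inj₂ l) → ⊥
    disjoint (_ , _ , refl) (_ , _ , ())

  ∈-blocks-copy : ∀ i j → inj₁ (i , j) ∈ blocks
  ∈-blocks-copy i j = ∈-++⁺ˡ (∈-map⁺ inj₁ (∈-cartesianProduct⁺ (∈-allFin i) (∈-allFin j)))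

  ∈-blocks-lift : ∀ {l} → ¬ IsGroup l → inj₂ l ∈ blocks
  ∈-blocks-lift {j , a , b} ¬group = ∈-++⁺ʳ (map inj₁ copyBlocks)
    (∈-map⁺ inj₂ (∈-filter⁺ (¬? ∘ isGroup?)
      (∈-cartesianProduct⁺ (∈-allFin j) (∈-cartesianProduct⁺ (∈-allFin a) (∈-allFin b))) ¬group))

  ∈-blocks-lift⁻ : ∀ {l} → inj₂ l ∈ blocks → ¬ IsGroup l
  ∈-blocks-lift⁻ l∈ with ∈-++⁻ (map inj₁ copyBlocks) l∈
  ... | inj₁ l∈₁ with _ , _ , () ← ∈-map⁻ inj₁ l∈₁
  ... | inj₂ l∈₂ with _ , l∈' , refl ← ∈-map⁻ inj₂ l∈₂ =
    proj₂ (∈-filter⁻ (¬? ∘ isGroup?) {xs = cartesianProduct (allFin _) (cartesianProduct (allFin 7) (allFin 7))} l∈')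

  ∈-copyBlock⁻ : ∀ {i j p} → p ∈ members (inj₁ (i , j)) → OnCopy i p × uncopy p ∈ D.block j
  ∈-copyBlock⁻ {i} p∈ with u , u∈ , refl ← ∈-map⁻ (copy i) p∈ =
    copy-OnCopy i u , subst (_∈ D.block _) (sym (uncopy-copy i u)) u∈

  ∈-copyBlock⁺ : ∀ {i j p} → OnCopy i p → uncopy p ∈ D.block j → p ∈ members (inj₁ (i , j))
  ∈-copyBlock⁺ {i} {j} {p} onCopy u∈ = subst (_∈ members (inj₁ (i , j))) (copy-uncopy i p onCopy) (∈-map⁺ (copy i) u∈)

  ∈-liftBlock⁻ : ∀ {j a b p} → p ∈ members (inj₂ (j , a , b)) → ∃[ x ] x ∈ block j × Kept x × p ≡ lift a b x
  ∈-liftBlock⁻ {j} {a} {b} p∈ with x , x∈ , refl ← ∈-map⁻ (lift a b) p∈ =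
    x , proj₁ (∈-filter⁻ kept? {xs = block j} x∈) , proj₂ (∈-filter⁻ kept? {xs = block j} x∈) , refl

  ∈-liftBlock⁺ : ∀ {j a b x} → x ∈ block j → Kept x → lift a b x ∈ members (inj₂ (j , a , b))
  ∈-liftBlock⁺ {a = a} {b} x∈ kept = ∈-map⁺ (lift a b) (∈-filter⁺ kept? x∈ kept)

  members-unique : ∀ β → Unique (members β)
  members-unique (inj₁ (i , j))     = Uniqueₚ.map⁺ (copy-injective i) (D.blockSet j)
  members-unique (inj₂ (j , a , b)) =
    Uniqueₚ.map⁺ (cong proj₁ ∘ Maybeₚ.just-injective) (Uniqueₚ.filter⁺ kept? (blockSet j))

  members⊆points : ∀ β {p} → p ∈ members β → p ∈ points
  members⊆points (inj₁ (i , j)) p∈ = OnCopy-∈-points i _ (proj₁ (∈-copyBlock⁻ p∈))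
  members⊆points (inj₂ _)       p∈ with _ , _ , kept , refl ← ∈-liftBlock⁻ p∈ = ∈-points⁺ _ kept

  block-size : ∀ β → length (members β) ≡ 7 ⊎ length (members β) ≡ 8
  block-size (inj₁ (i , j))     = inj₁ (trans (length-map (copy i) (D.block j)) (D.blockSize j))
  block-size (inj₂ (j , a , b))
    with +≡suc⇒≡∨≡pred _ _ (trans (length-filter-complement kept? (block j)) (blockSize j))
                           (length-filter-block≤1 j (¬? ∘ kept?) unkept⇒long)
  ... | inj₁ eq = inj₂ (trans (length-map (lift a b) (filter kept? (block j))) eq)
  ... | inj₂ eq = inj₁ (trans (length-map (lift a b) (filter kept? (block j))) eq)

  groupNo-injective-OnCopy : ∀ {i p q} → OnCopy i p → OnCopy i q → groupNo p ≡ groupNo q → p ≡ q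
  groupNo-injective-OnCopy {p = nothing}       {nothing}        _   _   _  = refl
  groupNo-injective-OnCopy {p = nothing}       {just (y , s)}   _   gy≡ eq =
    ⊥-elim (<-irrefl (sym eq) (groupNo-short< s (inject₁-short gy≡)))
  groupNo-injective-OnCopy {p = just (x , s)}  {nothing}        gx≡ _   eq =
    ⊥-elim (<-irrefl eq (groupNo-short< s (inject₁-short gx≡)))
  groupNo-injective-OnCopy {p = just (x , s)}  {just (y , s')}  gx≡ gy≡ eq =
    cong₂ (λ z v → just (z , v)) (same-slot⇒≡ sx sy (trans gx≡ (sym gy≡)) (proj₂ same)) (proj₁ same)
    where
    sx = inject₁-short gx≡
    sy = inject₁-short gy≡
    same = groupNo-short-injective sx sy eq

  lift-groupNo-injective : ∀ {j a b x y} → ¬ IsGroup (j , a , b) → x ∈ block j → y ∈ block j →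
                           groupOf x ≢ groupOf y → groupNo (lift a b x) ≢ groupNo (lift a b y)
  lift-groupNo-injective {j} {a} {b} {x} {y} ¬group x∈ y∈ gx≢gy eq = by-cases (short? x) (short? y)
    where
    by-cases : Dec (Short x) → Dec (Short y) → ⊥
    by-cases (no lx)  (no ly)  = gx≢gy (trans (long⇒≡g₇ lx) (sym (long⇒≡g₇ ly)))
    by-cases (yes sx) (no ly)  = <-irrefl (trans eq (groupNo-long _ ly)) (groupNo-short< _ sx)
    by-cases (no lx)  (yes sy) = <-irrefl (trans (sym eq) (groupNo-long _ lx)) (groupNo-short< _ sy)
    by-cases (yes sx) (yes sy) =
      ¬group (subst (λ j' → pivot ∈ block j') (sym j≡) (pivot-∈-pivotBlockAt _) , horizontal)
      where
      same = groupNo-short-injective sx sy eq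
      j≡ : j ≡ pivotBlockAt (slot x sx)
      j≡ = block-unique gx≢gy x∈ y∈ (∈-pivotBlockAt-slot x sx)
             (subst (λ k → y ∈ block (pivotBlockAt k)) (sym (proj₂ same)) (∈-pivotBlockAt-slot y sy))
      horizontal : a ≡ fzero
      horizontal with equal-values⇒horizontal (groupOf x) (groupOf y) a b
      ... | inj₁ gx≡ = ⊥-elim (sx gx≡)
      ... | inj₂ (inj₁ gy≡) = ⊥-elim (sy gy≡)
      ... | inj₂ (inj₂ (inj₁ gx≡gy)) = ⊥-elim (gx≢gy gx≡gy)
      ... | inj₂ (inj₂ (inj₂ (inj₁ line≢))) = ⊥-elim (line≢ (proj₁ same))
      ... | inj₂ (inj₂ (inj₂ (inj₂ a≡0))) = a≡0

  blocks-transverse : ∀ β → β ∈ blocks → ∀ {p q} → p ∈ members β → q ∈ members β → p ≢ q → groupNo p ≢ groupNo q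
  blocks-transverse (inj₁ _) _ p∈ q∈ p≢q =
    p≢q ∘ groupNo-injective-OnCopy (proj₁ (∈-copyBlock⁻ p∈)) (proj₁ (∈-copyBlock⁻ q∈))
  blocks-transverse (inj₂ (j , a , b)) β∈ p∈ q∈ p≢q with ∈-liftBlock⁻ p∈ | ∈-liftBlock⁻ q∈
  ... | x , x∈ , _ , refl | y , y∈ , _ , refl =
    lift-groupNo-injective (∈-blocks-lift⁻ β∈) x∈ y∈ (p≢q ∘ cong (lift a b) ∘ same-group⇒≡ j x∈ y∈)

  Covered : Point → Point → Set
  Covered p q = ∃[ β ] β ∈ blocks × p ∈ members β × q ∈ members β

  Covered-sym : ∀ {p q} → Covered p q → Covered q p
  Covered-sym (β , β∈ , p∈ , q∈) = β , β∈ , q∈ , p∈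

  covered-in-copy : ∀ i {p q} → OnCopy i p → OnCopy i q → p ≢ q → Covered p q
  covered-in-copy i {p} {q} onp onq p≢q =
    inj₁ (i , j) , ∈-blocks-copy i j , ∈-copyBlock⁺ onp (proj₁ u,u'∈) , ∈-copyBlock⁺ onq (proj₂ u,u'∈)
    where
    u≢u' : uncopy p ≢ uncopy q
    u≢u' eq = p≢q (trans (sym (copy-uncopy i p onp)) (trans (cong (copy i) eq) (copy-uncopy i q onq)))
    j = proj₁ (D.pairs (uncopy p) (uncopy q) u≢u')
    u,u'∈ = proj₁ (proj₂ (D.pairs (uncopy p) (uncopy q) u≢u'))

  covered-by-lift : ∀ {x y s s'} → Kept x → Kept y → groupOf x ≢ groupOf y →
                    groupNo (just (x , s)) ≢ groupNo (just (y , s')) → Covered (just (x , s)) (just (y , s'))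
  covered-by-lift {x} {y} {s} {s'} kx ky gx≢gy groupNo≢ with line-lineThrough (groupOf x) (groupOf y) s s'
  ... | inj₁ gx≡gy = ⊥-elim (gx≢gy gx≡gy)
  ... | inj₂ (line-x , line-y) =
    inj₂ (j , a , b) , ∈-blocks-lift ¬group ,
    subst (λ v → just (x , v) ∈ members (inj₂ (j , a , b))) line-x (∈-liftBlock⁺ x∈ kx) ,
    subst (λ v → just (y , v) ∈ members (inj₂ (j , a , b))) line-y (∈-liftBlock⁺ y∈ ky)
    where
    j = blockThrough x y gx≢gy
    x∈ = ∈-blockThroughˡ x y gx≢gy
    y∈ = ∈-blockThroughʳ x y gx≢gy
    a = proj₁ (lineThrough (groupOf x) (groupOf y) s s')
    b = proj₂ (lineThrough (groupOf x) (groupOf y) s s')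
    ¬group : ¬ IsGroup (j , a , b)
    ¬group (pivot∈ , a≡0) = groupNo≢ (begin
      groupNo (just (x , s))               ≡⟨ groupNo-short s sx ⟩
      toℕ (combine s (slot x sx))          ≡⟨ cong₂ (λ v k → toℕ (combine v k)) s≡s' (sym slot≡) ⟩
      toℕ (combine s' (slot y sy))         ≡⟨ groupNo-short s' sy ⟨
      groupNo (just (y , s'))              ∎)
      where
      open ≡-Reasoning
      sx = kept-in-pivot-block⇒short kx x∈ pivot∈
      sy = kept-in-pivot-block⇒short ky y∈ pivot∈
      on-horizontal : ∀ {z v} → Short z → line (groupOf z) a b ≡ v → b ≡ v
      on-horizontal {z} sz line≡ with line-horizontal (groupOf z) b
      ... | inj₁ long = ⊥-elim (sz long)
      ... | inj₂ line₀≡ = trans (sym line₀≡) (trans (cong (λ a' → line (groupOf z) a' b) (sym a≡0)) line≡)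
      s≡s' : s ≡ s'
      s≡s' = trans (sym (on-horizontal sx line-x)) (on-horizontal sy line-y)
      slot≡ : slot y sy ≡ slot x sx
      slot≡ = slot-unique y sy (slot x sx) (subst (λ j' → y ∈ block j') (pivot-block-slot x sx x∈ pivot∈) y∈)

  covered : ∀ {p q} → p ∈ points → q ∈ points → groupNo p ≢ groupNo q → Covered p q
  covered {nothing}       {nothing}        _  _  g≢ = ⊥-elim (g≢ refl)
  covered {nothing}       {just (y , s)}   _  _  g≢ = covered-from-∞ (short? y)
    where
    covered-from-∞ : Dec (Short y) → Covered nothing (just (y , s))
    covered-from-∞ (yes sy) = covered-in-copy (proj₁ (short⇒inject₁ sy)) tt (proj₂ (short⇒inject₁ sy)) λ ()
    covered-from-∞ (no  ly) = ⊥-elim (g≢ (sym (groupNo-long s ly)))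
  covered {just (x , s)}  {nothing}        p∈ q∈ g≢ = Covered-sym (covered q∈ p∈ (g≢ ∘ sym))
  covered {just (x , s)}  {just (y , s')}  p∈ q∈ g≢ with groupOf x Finₚ.≟ groupOf y
  ... | no  gx≢gy = covered-by-lift (∈-points⁻ p∈) (∈-points⁻ q∈) gx≢gy g≢
  ... | yes gx≡gy = same-group (short? x)
    where
    same-group : Dec (Short x) → Covered (just (x , s)) (just (y , s'))
    same-group (yes sx) = covered-in-copy i gx≡ (trans (sym gx≡gy) gx≡) (g≢ ∘ cong groupNo)
      where
      i = proj₁ (short⇒inject₁ sx)
      gx≡ = proj₂ (short⇒inject₁ sx)
    same-group (no lx) = ⊥-elim (g≢ (trans (groupNo-long s lx) (sym (groupNo-long s' ly))))
      where
      ly : ¬ Short y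
      ly sy = lx (λ gx≡g₇ → sy (trans (sym gx≡gy) gx≡g₇))

  D-block-unique : ∀ {u u'} → u ≢ u' → ∀ {j j'} →
                   u ∈ D.block j → u' ∈ D.block j → u ∈ D.block j' → u' ∈ D.block j' → j ≡ j'
  D-block-unique u≢u' u∈j u'∈j u∈j' u'∈j' =
    trans (sym (proj₂ (proj₂ (D.pairs _ _ u≢u')) (u∈j , u'∈j))) (proj₂ (proj₂ (D.pairs _ _ u≢u')) (u∈j' , u'∈j'))

  OnCopy-pair-unique : ∀ {i i' p q} → p ≢ q → OnCopy i p → OnCopy i q → OnCopy i' p → OnCopy i' q → i ≡ i'
  OnCopy-pair-unique {p = nothing}      {nothing}      p≢q _  _  _   _   = ⊥-elim (p≢q refl)
  OnCopy-pair-unique {p = just (x , s)} {_}            _   op _  op' _   = OnCopy-unique {x = x} {s} op op'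
  OnCopy-pair-unique {p = nothing}      {just (y , s)} _   _  oq _   oq' = OnCopy-unique {x = y} {s} oq oq'

  copy-lift-disjoint : ∀ {i j' j a b p q} → p ≢ q → p ∈ members (inj₁ (i , j')) → q ∈ members (inj₁ (i , j')) →
                       p ∈ members (inj₂ (j , a , b)) → q ∈ members (inj₂ (j , a , b)) → ⊥
  copy-lift-disjoint {j = j} {a} {b} p≢q p∈ q∈ p∈' q∈'
    with x , x∈ , _ , refl ← ∈-liftBlock⁻ p∈' | y , y∈ , _ , refl ← ∈-liftBlock⁻ q∈'
    = p≢q (cong (lift a b) (same-group⇒≡ j x∈ y∈ (trans (proj₁ (∈-copyBlock⁻ p∈)) (sym (proj₁ (∈-copyBlock⁻ q∈))))))

  covered-once : ∀ β β' {p q} → p ≢ q → p ∈ members β → q ∈ members β → p ∈ members β' → q ∈ members β' → β ≡ β'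
  covered-once (inj₁ (i , j)) (inj₁ (i' , j')) {p} {q} p≢q p∈ q∈ p∈' q∈'
    with refl ← OnCopy-pair-unique p≢q (proj₁ (∈-copyBlock⁻ p∈)) (proj₁ (∈-copyBlock⁻ q∈))
                                       (proj₁ (∈-copyBlock⁻ p∈')) (proj₁ (∈-copyBlock⁻ q∈'))
    = cong (λ j'' → inj₁ (i , j'')) (D-block-unique u≢u'
        (proj₂ (∈-copyBlock⁻ p∈)) (proj₂ (∈-copyBlock⁻ q∈)) (proj₂ (∈-copyBlock⁻ p∈')) (proj₂ (∈-copyBlock⁻ q∈')))
    where
    u≢u' : uncopy p ≢ uncopy q
    u≢u' eq = p≢q (trans (sym (copy-uncopy i p (proj₁ (∈-copyBlock⁻ p∈))))
                    (trans (cong (copy i) eq) (copy-uncopy i q (proj₁ (∈-copyBlock⁻ q∈)))))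
  covered-once (inj₂ (j , a , b)) (inj₂ (j' , a' , b')) p≢q p∈ q∈ p∈' q∈'
    with x , x∈ , _ , refl ← ∈-liftBlock⁻ p∈ | y , y∈ , _ , refl ← ∈-liftBlock⁻ q∈
       | x' , x∈' , _ , eqx ← ∈-liftBlock⁻ p∈' | y' , y∈' , _ , eqy ← ∈-liftBlock⁻ q∈'
    with refl ← cong proj₁ (Maybeₚ.just-injective eqx) | refl ← cong proj₁ (Maybeₚ.just-injective eqy)
    = cong₂ (λ j'' ab → inj₂ (j'' , ab)) (block-unique gx≢gy x∈ y∈ x∈' y∈') ab≡
    where
    gx≢gy : groupOf x ≢ groupOf y
    gx≢gy = p≢q ∘ cong (lift a b) ∘ same-group⇒≡ j x∈ y∈
    ab≡ : (a , b) ≡ (a' , b')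
    ab≡ with lineThrough-line (groupOf x) (groupOf y) a b | lineThrough-line (groupOf x) (groupOf y) a' b'
    ... | inj₁ gx≡gy | _ = ⊥-elim (gx≢gy gx≡gy)
    ... | inj₂ _     | inj₁ gx≡gy = ⊥-elim (gx≢gy gx≡gy)
    ... | inj₂ ab≡   | inj₂ a'b'≡ = trans (sym ab≡) (trans
          (cong₂ (lineThrough (groupOf x) (groupOf y))
                 (cong proj₂ (Maybeₚ.just-injective eqx)) (cong proj₂ (Maybeₚ.just-injective eqy)))
          a'b'≡)
  covered-once (inj₁ (i , _)) (inj₂ (j , a , b)) p≢q p∈ q∈ p∈' q∈' = ⊥-elim (copy-lift-disjoint p≢q p∈ q∈ p∈' q∈')
  covered-once (inj₂ (j , a , b)) (inj₁ (i , _)) p≢q p∈ q∈ p∈' q∈' = ⊥-elim (copy-lift-disjoint p≢q p∈' q∈' p∈ q∈)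

  type : List ℕ
  type = replicate (7 * m) 7 ++ [ 7 * t + 1 ]

  length-type : length type ≡ 7 * m + 1
  length-type = trans (length-++ (replicate (7 * m) 7)) (cong (_+ 1) (length-replicate (7 * m)))

  groupNo< : ∀ p → groupNo p < length type
  groupNo< p = subst (groupNo p <_) (trans (+-comm 1 (7 * m)) (sym length-type)) (s≤s (groupNo≤ p))

  hasGroupNo? : ∀ c → Decidable (λ p → groupNo p ≡ c)
  hasGroupNo? c p = groupNo p ℕ.≟ c

  keptLongPoint : Fin t → X
  keptLongPoint k = member g₇ (inject≤ k (<⇒≤ t<m))

  keptLong : List X
  keptLong = tabulate keptLongPoint

  ∈-keptLong⁻ : ∀ {x} → x ∈ keptLong → ¬ Short x × toℕ (position x) < t
  ∈-keptLong⁻ x∈ with k , refl ← ∈-tabulate⁻ x∈ =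
    (λ short → short (groupOf-member g₇ _)) ,
    subst (_< t) (trans (sym (Finₚ.toℕ-inject≤ k _)) (cong toℕ (sym (position-member g₇ _)))) (Finₚ.toℕ<n k)

  ∈-keptLong⁺ : ∀ {x} → ¬ Short x → toℕ (position x) < t → x ∈ keptLong
  ∈-keptLong⁺ {x} long <t = subst (_∈ keptLong) member≡x (∈-tabulate⁺ (fromℕ< <t))
    where
    open ≡-Reasoning
    member≡x : member g₇ (inject≤ (fromℕ< <t) (<⇒≤ t<m)) ≡ x
    member≡x = begin
      member g₇ (inject≤ (fromℕ< <t) (<⇒≤ t<m))  ≡⟨ cong (member g₇) (Finₚ.toℕ-injective
                                                        (trans (Finₚ.toℕ-inject≤ _ _) (Finₚ.toℕ-fromℕ< <t))) ⟩
      member g₇ (position x)                          ≡⟨ cong (λ g → member g (position x)) (long⇒≡g₇ long) ⟨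
      member (groupOf x) (position x)                 ≡⟨ member-position x ⟩
      x                                               ∎

  longGroup : List Point
  longGroup = nothing ∷ map just (cartesianProduct keptLong (allFin 7))

  count-long : length (filter (hasGroupNo? (7 * m)) points) ≡ 7 * t + 1
  count-long =
    trans (Unique-⇔⇒length-≡ (Uniqueₚ.filter⁺ (hasGroupNo? (7 * m)) points-unique) longGroup-unique to from)
                     length-longGroup
    where
    longGroup-unique : Unique longGroup
    longGroup-unique = Allₚ.map⁺ (All.universal (λ _ ()) (cartesianProduct keptLong (allFin 7)))
      ∷ Uniqueₚ.map⁺ Maybeₚ.just-injective (Uniqueₚ.cartesianProduct⁺
          (Uniqueₚ.tabulate⁺ {f = keptLongPoint} (Finₚ.inject≤-injective _ _ _ _ ∘ member-injective g₇))
          (Uniqueₚ.allFin⁺ 7))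
    length-longGroup : length longGroup ≡ 7 * t + 1
    length-longGroup = begin
      suc (length (map just (cartesianProduct keptLong (allFin 7))))
        ≡⟨ cong suc (length-map just (cartesianProduct keptLong (allFin 7))) ⟩
      suc (length (cartesianProduct keptLong (allFin 7)))
        ≡⟨ cong suc (length-cartesianProduct keptLong (allFin 7)) ⟩
      suc (length keptLong * length (allFin 7))
        ≡⟨ cong suc (cong₂ _*_ (length-tabulate keptLongPoint) (length-tabulate {n = 7} id)) ⟩
      suc (t * 7)                                                     ≡⟨ cong suc (*-comm t 7) ⟩
      suc (7 * t)                                                     ≡⟨ +-comm 1 (7 * t) ⟩
      7 * t + 1                                                       ∎
      where open ≡-Reasoning
    to : ∀ {p} → p ∈ filter (hasGroupNo? (7 * m)) points → p ∈ longGroup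
    to {nothing}      _  = here refl
    to {just (x , s)} p∈ = by-kept (∈-points⁻ (proj₁ p∈'))
      where
      p∈' = ∈-filter⁻ (hasGroupNo? (7 * m)) {xs = points} p∈
      long : ¬ Short x
      long short = <-irrefl (proj₂ p∈') (groupNo-short< s short)
      by-kept : Kept x → just (x , s) ∈ longGroup
      by-kept (inj₁ short) = ⊥-elim (long short)
      by-kept (inj₂ <t)    = there (∈-map⁺ just (∈-cartesianProduct⁺ (∈-keptLong⁺ long <t) (∈-allFin s)))
    from : ∀ {p} → p ∈ longGroup → p ∈ filter (hasGroupNo? (7 * m)) points
    from (here refl) = ∈-filter⁺ (hasGroupNo? (7 * m)) (here refl) refl
    from (there p∈)
      with (x , s) , w∈ , refl ← ∈-map⁻ just p∈
      with long , <t ← ∈-keptLong⁻ (proj₁ (∈-cartesianProduct⁻ keptLong (allFin 7) w∈)) =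
      ∈-filter⁺ (hasGroupNo? (7 * m)) (∈-points⁺ s (inj₂ <t)) (groupNo-long s long)

  length-short-in-pivotBlock : ∀ k → length (filter short? (block (pivotBlockAt k))) ≡ 7
  length-short-in-pivotBlock k = +-cancelʳ-≡ 1 _ 7 (begin
    length (filter short? Bₖ) + 1                          ≡⟨ cong (length (filter short? Bₖ) +_) long≡1 ⟨
    length (filter short? Bₖ) + length (filter long? Bₖ)   ≡⟨ length-filter-complement short? Bₖ ⟩
    length Bₖ                                              ≡⟨ blockSize (pivotBlockAt k) ⟩
    8                                                     ∎)
    where
    open ≡-Reasoning
    Bₖ = block (pivotBlockAt k)
    long? = ¬? ∘ short?
    long≡1 : length (filter long? Bₖ) ≡ 1
    long≡1 = ≤-antisym (length-filter-block≤1 (pivotBlockAt k) long? long⇒≡g₇)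
               (filter-some long? (lose (pivot-∈-pivotBlockAt k) (λ short → short groupOf-pivot)))

  count-short : ∀ c → c < 7 * m → length (filter (hasGroupNo? c) points) ≡ 7
  count-short c c< = begin
    length (filter (hasGroupNo? c) points)
      ≡⟨ Unique-⇔⇒length-≡ (Uniqueₚ.filter⁺ (hasGroupNo? c) points-unique) shortGroup-unique to from ⟩
    length shortGroup
      ≡⟨ length-map (λ x → just (x , s)) (filter short? (block (pivotBlockAt k))) ⟩
    length (filter short? (block (pivotBlockAt k)))
      ≡⟨ length-short-in-pivotBlock k ⟩
    7 ∎
    where
    open ≡-Reasoning
    s = proj₁ (remQuot m (fromℕ< c<))
    k = proj₂ (remQuot m (fromℕ< c<))
    shortGroup : List Point
    shortGroup = map (λ x → just (x , s)) (filter short? (block (pivotBlockAt k)))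
    shortGroup-unique : Unique shortGroup
    shortGroup-unique = Uniqueₚ.map⁺ (cong proj₁ ∘ Maybeₚ.just-injective) (Uniqueₚ.filter⁺ short? (blockSet _))
    c≡ : toℕ (combine s k) ≡ c
    c≡ = trans (cong toℕ (Finₚ.combine-remQuot {n = 7} m (fromℕ< c<))) (Finₚ.toℕ-fromℕ< c<)
    to : ∀ {p} → p ∈ filter (hasGroupNo? c) points → p ∈ shortGroup
    to {nothing}       p∈ = ⊥-elim (<-irrefl (sym (proj₂ (∈-filter⁻ (hasGroupNo? c) {xs = points} p∈))) c<)
    to {just (x , s')} p∈ = by-short (short? x)
      where
      g≡ = proj₂ (∈-filter⁻ (hasGroupNo? c) {xs = points} p∈)
      by-short : Dec (Short x) → just (x , s') ∈ shortGroup
      by-short (no long)  = ⊥-elim (<-irrefl (trans (sym g≡) (groupNo-long s' long)) c<)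
      by-short (yes short) = subst (λ v → just (x , v) ∈ shortGroup) (sym (proj₁ same))
          (∈-map⁺ (λ x → just (x , s)) (∈-filter⁺ short? x∈ short))
        where
        same = Finₚ.combine-injective s' (slot x short) s k
                 (Finₚ.toℕ-injective (trans (sym (groupNo-short s' short)) (trans g≡ (sym c≡))))
        x∈ : x ∈ block (pivotBlockAt k)
        x∈ = subst (λ k' → x ∈ block (pivotBlockAt k')) (proj₂ same) (∈-pivotBlockAt-slot x short)
    from : ∀ {p} → p ∈ shortGroup → p ∈ filter (hasGroupNo? c) points
    from p∈ with x , x∈' , refl ← ∈-map⁻ (λ x → just (x , s)) p∈ =
      ∈-filter⁺ (hasGroupNo? c) (∈-points⁺ s (inj₁ short))
        (trans (groupNo-short s short) (trans (cong (toℕ ∘ combine s) (slot-unique x short k x∈)) c≡))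
      where
      x∈ = proj₁ (∈-filter⁻ short? {xs = block (pivotBlockAt k)} x∈')
      short = proj₂ (∈-filter⁻ short? {xs = block (pivotBlockAt k)} x∈')

  group-size : ∀ i → length (filter (hasGroupNo? (toℕ i)) points) ≡ lookup type i
  group-size i with toℕ i ℕ.<? 7 * m
  ... | yes i< = trans (count-short (toℕ i) i<) (sym (lookup-replicate-++ˡ (7 * m) 7 _ i i<))
  ... | no  i≮ = trans (subst (λ c → length (filter (hasGroupNo? c) points) ≡ 7 * t + 1) (sym i≡) count-long)
                       (sym (lookup-replicate-++ʳ (7 * m) 7 (7 * t + 1) i i≮))
    where
    i≡ : toℕ i ≡ 7 * m
    i≡ = ≤-antisym (<⇒≤pred (subst (toℕ i <_) (trans length-type (+-comm (7 * m) 1)) (Finₚ.toℕ<n i)))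
                      (≮⇒≥ i≮)

  listGDD : ListGDD (λ s → s ≡ 7 ⊎ s ≡ 8) type
  listGDD = record
    { Point          = Point
    ; _≟_            = Maybeₚ.≡-dec (×ₚ.≡-dec Finₚ._≟_ Finₚ._≟_)
    ; points         = points
    ; points-unique  = points-unique
    ; group          = groupNo
    ; group<         = groupNo<
    ; group-size     = group-size
    ; Block          = Block
    ; blocks         = blocks
    ; blocks-unique  = blocks-unique
    ; members        = members
    ; members-unique = members-unique
    ; members⊆points = members⊆points
    ; block-size     = block-size
    ; transverse     = blocks-transverse
    ; covered        = covered
    ; covered-once   = covered-once
    }

corollary5 : (m t : ℕ) → 0 < m → TD 8 m → BIBD (7 * m + 1) 7 → t ≤ m ∸ 1 →
    GDD (λ s → s ≡ 7 ⊎ s ≡ 8) (replicate (7 * m) 7 ++ [ 7 * t + 1 ])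
corollary5 (suc m) t _ T D t≤m = listGDD⇒GDD (Construction.listGDD (suc m) t (s≤s t≤m) T D)
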